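{- Let $k\ge 1$ be an integer. The exponential generating function $\sum_{n\ge 0}|\mathcal{S}_n(a\text{ - }a_1\cdots a_k)|\,x^n/n!$ of permutations avoiding the partially ordered pattern $a\text{ - }a_1\cdots a_k$ equals $\exp\left(\sum_{i=1}^{k}x^i/i\right)$.
   Context: $\mathcal{S}_n$ is the set of permutations of $\{1,\dots,n\}$ written as words $\pi_1\cdots\pi_n$ ($\mathcal{S}_0$ consists of the empty permutation). The pattern $a\text{ - }a_1\cdots a_k$ is built on the poset with elements $a,a_1,\dots,a_k$ whose only relations are $a<a_i$ for all $i$. An occurrence of $a\text{ - }a_1\cdots a_k$ in $\pi\in\mathcal{S}_n$ is a pair of indices $i<j$ with $j+k-1\le n$ such that $\pi_i<\pi_{j+t}$ for all $t=0,\dots,k-1$. $\mathcal{S}_n(a\text{ - }a_1\cdots a_k)$ is the set of permutations in $\mathcal{S}_n$ with no occurrence. -}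

module Defs where

open import Data.Bool using (Bool; true; false; not; _∧_; if_then_else_)
open import Data.Nat using (ℕ; zero; suc; _+_; _∸_; _!; _<ᵇ_; _≤ᵇ_; _≡ᵇ_)
open import Data.Nat.Properties using (_!≢0)
open import Data.List using (List; []; _∷_; [_]; map; concatMap; upTo; filterᵇ; length)
open import Data.Bool.ListAction using (any; all)
open import Data.Integer using (+_)
open import Data.Rational using (ℚ; 0ℚ; 1ℚ; _/_) renaming (_+_ to _+ℚ_; _*_ to _*ℚ_)

-- Convention: positions and values are shifted down by one, i.e. a
-- permutation of length n is a word over {0,…,n-1} (a List ℕ) of length
-- n with pairwise distinct letters.  This is an order-preserving relabelling.

words : ℕ → ℕ → List (List ℕ)
words a zero    = [ [] ]
words a (suc l) = concatMap (λ x → map (x ∷_) (words a l)) (upTo a)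

distinct : List ℕ → Bool
distinct []       = true
distinct (x ∷ xs) = not (any (λ y → x ≡ᵇ y) xs) ∧ distinct xs

perms : ℕ → List (List ℕ)
perms n = filterᵇ distinct (words n n)

-- the letter at (0-based) position i; default 0 outside the word
-- (never used outside the word below, thanks to the range guards)
at : List ℕ → ℕ → ℕ
at []       i       = 0
at (x ∷ xs) zero    = x
at (x ∷ xs) (suc i) = at xs i

occurs : ℕ → List ℕ → Bool
occurs k π =
  any (λ i → any (λ j →
        (i <ᵇ j) ∧ ((j + k) ≤ᵇ length π) ∧ all (λ t → at π i <ᵇ at π (j + t)) (upTo k))
      (upTo (length π)))
    (upTo (length π))

avoidCount : ℕ → ℕ → ℕ
avoidCount k n = length (filterᵇ (λ π → not (occurs k π)) (perms n))

PS : Set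
PS = ℕ → ℚ

sumTo : ℕ → (ℕ → ℚ) → ℚ
sumTo zero    f = f 0
sumTo (suc n) f = sumTo n f +ℚ f (suc n)

_⊗_ : PS → PS → PS
(f ⊗ g) n = sumTo n (λ i → f i *ℚ g (n ∸ i))

onePS : PS
onePS zero    = 1ℚ
onePS (suc n) = 0ℚ

powPS : PS → ℕ → PS
powPS f zero    = onePS
powPS f (suc m) = f ⊗ powPS f m

-- exp(f) = Σ_{m≥0} f^m / m!  for f with zero constant term; since then
-- f^m has no terms of degree < m, the coefficient of xⁿ only receives
-- contributions from m ≤ n.
expPS : PS → PS
expPS f n = sumTo n (λ m → powPS f m n *ℚ ((+ 1) / (m !)) {{m !≢0}})

logSeries : ℕ → PS
logSeries k zero    = 0ℚ
logSeries k (suc i) = if suc i ≤ᵇ k then (+ 1) / suc i else 0ℚ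

avoidEGF : ℕ → PS
avoidEGF k n = ((+ avoidCount k n) / (n !)) {{n !≢0}}

-- Write π = σ 1 τ with 1 its least letter. No letter lies below 1, so a window
-- of an occurrence never contains 1; hence π contains a-a₁⋯a_k iff σ does or
-- |τ| ≥ k, and in the latter case 1 itself serves as a. Choosing the j < k
-- letters of τ in order and an avoider σ of the remaining letters gives
-- a_n = Σ_{j<k} (n-1)!/(n-1-j)! · a_{n-1-j}: the EGF A of the avoiders satisfies
-- θA = θL · A, where θ = x d/dx and L = Σ_{i=1}^{k} xⁱ/i. Since
-- θ(Lᵐ) = m · θL · Lᵐ⁻¹, exp L satisfies the same equation, and a solution is
-- determined by its constant term because θL has none.

module Submission where

open import Defs
open import Data.Nat using (ℕ; _≤_)
open import Relation.Binary.PropositionalEquality using (_≡_; refl; module ≡-Reasoning)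

module NatToRational where

  open import Data.Nat as ℕ using (ℕ; suc; NonZero)
  open import Data.Integer as ℤ using (+_)
  import Data.Integer.Properties as ℤ
  import Data.Nat.Coprimality as Coprime
  open import Data.Rational using (ℚ; mkℚ; 1ℚ; _/_; 1/_; _+_; _*_; toℚᵘ)
  open import Data.Rational.Properties
  open import Data.Rational.Unnormalised as ℚᵘ using (mkℚᵘ; *≡*)
  import Data.Rational.Unnormalised.Properties as ℚᵘ
  open import Relation.Binary.PropositionalEquality

  fromℕ : ℕ → ℚ
  fromℕ n = mkℚ (+ n) 0 (Coprime.sym (Coprime.1-coprimeTo n))

  fromℕ-+ : ∀ m n → fromℕ (m ℕ.+ n) ≡ fromℕ m + fromℕ n
  fromℕ-+ m n = toℚᵘ-injective (ℚᵘ.≃-trans (*≡* eq) (ℚᵘ.≃-sym (toℚᵘ-homo-+ (fromℕ m) (fromℕ n))))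
    where
    eq : + (m ℕ.+ n) ℤ.* + 1 ≡ (+ m ℤ.* + 1 ℤ.+ + n ℤ.* + 1) ℤ.* + 1
    eq = begin
      + (m ℕ.+ n) ℤ.* + 1              ≡⟨ ℤ.*-identityʳ _ ⟩
      + (m ℕ.+ n)                       ≡⟨ ℤ.pos-+ m n ⟩
      + m ℤ.+ + n                       ≡⟨ cong₂ ℤ._+_ (ℤ.*-identityʳ (+ m)) (ℤ.*-identityʳ (+ n)) ⟨
      + m ℤ.* + 1 ℤ.+ + n ℤ.* + 1      ≡⟨ ℤ.*-identityʳ _ ⟨
      (+ m ℤ.* + 1 ℤ.+ + n ℤ.* + 1) ℤ.* + 1 ∎
      where open ≡-Reasoning

  fromℕ-* : ∀ m n → fromℕ (m ℕ.* n) ≡ fromℕ m * fromℕ n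
  fromℕ-* m n = toℚᵘ-injective (ℚᵘ.≃-trans (*≡* eq) (ℚᵘ.≃-sym (toℚᵘ-homo-* (fromℕ m) (fromℕ n))))
    where
    eq : + (m ℕ.* n) ℤ.* + 1 ≡ (+ m ℤ.* + n) ℤ.* + 1
    eq = cong (ℤ._* + 1) (ℤ.pos-* m n)

  -- The second step uses that + a / suc b is, by definition, fromℚᵘ (mkℚᵘ (+ a) b).
  /-*-fromℕ : ∀ a b .{{_ : NonZero b}} → (+ a / b) * fromℕ b ≡ fromℕ a
  /-*-fromℕ a (suc b) = toℚᵘ-injective (begin
    toℚᵘ ((+ a / suc b) * fromℕ (suc b))              ≈⟨ toℚᵘ-homo-* (+ a / suc b) (fromℕ (suc b)) ⟩
    toℚᵘ (+ a / suc b) ℚᵘ.* mkℚᵘ (+ suc b) 0          ≈⟨ ℚᵘ.*-congʳ (toℚᵘ-fromℚᵘ (mkℚᵘ (+ a) b)) ⟩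
    mkℚᵘ (+ a) b ℚᵘ.* mkℚᵘ (+ suc b) 0                ≈⟨ *≡* (ℤ.*-assoc (+ a) (+ suc b) (+ 1)) ⟩
    mkℚᵘ (+ a) 0 ∎)
    where open ℚᵘ.≃-Reasoning

  *-cancelʳ-fromℕ : ∀ b .{{_ : NonZero b}} {x y} → x * fromℕ b ≡ y * fromℕ b → x ≡ y
  *-cancelʳ-fromℕ (suc b) {x} {y} eq = begin
    x                              ≡⟨ *-identityʳ x ⟨
    x * 1ℚ                         ≡⟨ cong (x *_) (*-inverseʳ n) ⟨
    x * (n * 1/ n)                 ≡⟨ *-assoc x n (1/ n) ⟨
    (x * n) * 1/ n                 ≡⟨ cong (_* 1/ n) eq ⟩
    (y * n) * 1/ n                 ≡⟨ *-assoc y n (1/ n) ⟩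
    y * (n * 1/ n)                 ≡⟨ cong (y *_) (*-inverseʳ n) ⟩
    y * 1ℚ                         ≡⟨ *-identityʳ y ⟩
    y                              ∎
    where open ≡-Reasoning
          n = fromℕ (suc b)

  a/b≡a*[1/b] : ∀ a b .{{_ : NonZero b}} → + a / b ≡ fromℕ a * (+ 1 / b)
  a/b≡a*[1/b] a b = *-cancelʳ-fromℕ b (begin
    (+ a / b) * fromℕ b            ≡⟨ /-*-fromℕ a b ⟩
    fromℕ a                        ≡⟨ *-identityʳ (fromℕ a) ⟨
    fromℕ a * 1ℚ                   ≡⟨ cong (fromℕ a *_) (/-*-fromℕ 1 b) ⟨
    fromℕ a * ((+ 1 / b) * fromℕ b) ≡⟨ *-assoc (fromℕ a) (+ 1 / b) (fromℕ b) ⟨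
    fromℕ a * (+ 1 / b) * fromℕ b  ∎)
    where open ≡-Reasoning

module FiniteSums where

  open import Data.Nat as ℕ using (ℕ; zero; suc; _≤_; _<_; _∸_; z≤n)
  import Data.Nat.Properties as ℕ
  open import Data.Rational using (ℚ; 0ℚ; _+_; _*_)
  open import Data.Rational.Properties
  open import Algebra.Bundles using (CommutativeMonoid)
  open import Algebra.Properties.CommutativeSemigroup (CommutativeMonoid.commutativeSemigroup +-0-commutativeMonoid)
    using (interchange)
  open import Function using (_∘_)
  open import Data.Sum using (inj₁; inj₂)
  open import Relation.Binary.PropositionalEquality

  sumTo-cong-≤ : ∀ n {f g : ℕ → ℚ} → (∀ {i} → i ≤ n → f i ≡ g i) → sumTo n f ≡ sumTo n g
  sumTo-cong-≤ zero    f≡g = f≡g z≤n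
  sumTo-cong-≤ (suc n) f≡g = cong₂ _+_ (sumTo-cong-≤ n (f≡g ∘ ℕ.m≤n⇒m≤1+n)) (f≡g ℕ.≤-refl)

  sumTo-cong : ∀ n {f g : ℕ → ℚ} → f ≗ g → sumTo n f ≡ sumTo n g
  sumTo-cong n f≗g = sumTo-cong-≤ n (λ {i} _ → f≗g i)

  sumTo-zero : ∀ n {f : ℕ → ℚ} → (∀ {i} → i ≤ n → f i ≡ 0ℚ) → sumTo n f ≡ 0ℚ
  sumTo-zero zero    f≡0 = f≡0 z≤n
  sumTo-zero (suc n) f≡0 = cong₂ _+_ (sumTo-zero n (f≡0 ∘ ℕ.m≤n⇒m≤1+n)) (f≡0 ℕ.≤-refl)

  sumTo-+ : ∀ n (f g : ℕ → ℚ) → sumTo n (λ i → f i + g i) ≡ sumTo n f + sumTo n g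
  sumTo-+ zero    f g = refl
  sumTo-+ (suc n) f g = trans (cong (_+ (f (suc n) + g (suc n))) (sumTo-+ n f g))
                              (interchange (sumTo n f) (sumTo n g) (f (suc n)) (g (suc n)))

  *-sumToˡ : ∀ n c (f : ℕ → ℚ) → c * sumTo n f ≡ sumTo n (λ i → c * f i)
  *-sumToˡ zero    c f = refl
  *-sumToˡ (suc n) c f = trans (*-distribˡ-+ c (sumTo n f) (f (suc n))) (cong (_+ c * f (suc n)) (*-sumToˡ n c f))

  *-sumToʳ : ∀ n c (f : ℕ → ℚ) → sumTo n f * c ≡ sumTo n (λ i → f i * c)
  *-sumToʳ n c f = trans (*-comm (sumTo n f) c) (trans (*-sumToˡ n c f) (sumTo-cong n (λ i → *-comm c (f i))))

  sumTo-shift : ∀ n (f : ℕ → ℚ) → sumTo (suc n) f ≡ f 0 + sumTo n (f ∘ suc)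
  sumTo-shift zero    f = refl
  sumTo-shift (suc n) f = trans (cong (_+ f (suc (suc n))) (sumTo-shift n f)) (+-assoc (f 0) _ _)

  sumTo-extend : ∀ {m n} (f : ℕ → ℚ) → m ≤ n → (∀ {i} → m < i → f i ≡ 0ℚ) → sumTo n f ≡ sumTo m f
  sumTo-extend {n = zero}  f z≤n     _   = refl
  sumTo-extend {m} {suc n} f m≤1+n f≡0 with ℕ.m≤n⇒m<n∨m≡n m≤1+n
  ... | inj₁ m<1+n = begin
    sumTo n f + f (suc n) ≡⟨ cong₂ _+_ (sumTo-extend f (ℕ.≤-pred m<1+n) f≡0) (f≡0 m<1+n) ⟩
    sumTo m f + 0ℚ        ≡⟨ +-identityʳ (sumTo m f) ⟩
    sumTo m f             ∎
    where open ≡-Reasoning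
  ... | inj₂ refl = refl

  sumTo-reverse : ∀ n (f : ℕ → ℚ) → sumTo n f ≡ sumTo n (λ i → f (n ∸ i))
  sumTo-reverse zero    f = refl
  sumTo-reverse (suc n) f = begin
    sumTo n f + f (suc n)                          ≡⟨ cong (_+ f (suc n)) (sumTo-reverse n f) ⟩
    sumTo n (λ i → f (n ∸ i)) + f (suc n)          ≡⟨ +-comm _ (f (suc n)) ⟩
    f (suc n) + sumTo n (λ i → f (n ∸ i))          ≡⟨ sumTo-shift n (λ i → f (suc n ∸ i)) ⟨
    sumTo (suc n) (λ i → f (suc n ∸ i))            ∎
    where open ≡-Reasoning

  sumTo-swap : ∀ n m (a : ℕ → ℕ → ℚ) →
               sumTo n (λ i → sumTo m (a i)) ≡ sumTo m (λ j → sumTo n (λ i → a i j))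
  sumTo-swap zero    m a = refl
  sumTo-swap (suc n) m a = trans (cong (_+ sumTo m (a (suc n))) (sumTo-swap n m a))
                                 (sym (sumTo-+ m (λ j → sumTo n (λ i → a i j)) (a (suc n))))

  sumTo-triangle : ∀ n (a : ℕ → ℕ → ℚ) →
                   sumTo n (λ i → sumTo (n ∸ i) (a i)) ≡ sumTo n (λ s → sumTo s (λ i → a i (s ∸ i)))
  sumTo-triangle zero    a = refl
  sumTo-triangle (suc n) a = begin
    sumTo (suc n) (λ i → sumTo (suc n ∸ i) (a i))
      ≡⟨ sumTo-shift n _ ⟩
    sumTo (suc n) (a 0) + sumTo n (λ i → sumTo (n ∸ i) (a (suc i)))
      ≡⟨ cong₂ _+_ (sumTo-shift n (a 0)) (sumTo-triangle n (a ∘ suc)) ⟩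
    (a 0 0 + sumTo n (a 0 ∘ suc)) + sumTo n (λ s → sumTo s (λ i → a (suc i) (s ∸ i)))
      ≡⟨ +-assoc (a 0 0) _ _ ⟩
    a 0 0 + (sumTo n (a 0 ∘ suc) + sumTo n (λ s → sumTo s (λ i → a (suc i) (s ∸ i))))
      ≡⟨ cong (a 0 0 +_) (sumTo-+ n _ _) ⟨
    a 0 0 + sumTo n (λ s → a 0 (suc s) + sumTo s (λ i → a (suc i) (s ∸ i)))
      ≡⟨ cong (a 0 0 +_) (sumTo-cong n (λ s → sumTo-shift s (λ i → a i (suc s ∸ i)))) ⟨
    a 0 0 + sumTo n (λ s → sumTo (suc s) (λ i → a i (suc s ∸ i)))
      ≡⟨ sumTo-shift n _ ⟨
    sumTo (suc n) (λ s → sumTo s (λ i → a i (s ∸ i)))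
      ∎
    where open ≡-Reasoning

module PowerSeries where

  open import Data.Nat as ℕ using (ℕ; zero; suc; _≤_; _<_; _∸_; _!; z≤n; s≤s)
  import Data.Nat.Properties as ℕ
  import Data.Integer as ℤ
  open import Data.Rational using (ℚ; 0ℚ; 1ℚ; _/_; _+_; _*_)
  open import Data.Rational.Properties
  open import Data.Rational.Solver using (module +-*-Solver)
  open import Algebra.Bundles using (CommutativeMonoid)
  open import Algebra.Properties.CommutativeSemigroup (CommutativeMonoid.commutativeSemigroup *-1-commutativeMonoid)
    using (x∙yz≈y∙xz; xy∙z≈y∙xz)
  open import Data.Sum using (inj₁; inj₂)
  open import Relation.Binary.PropositionalEquality
  open NatToRational
  open FiniteSums
  open +-*-Solver

  _·_ : ℚ → PS → PS
  (c · f) n = c * f n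

  ⊗-cong : ∀ {f f′ g g′} → f ≗ f′ → g ≗ g′ → f ⊗ g ≗ f′ ⊗ g′
  ⊗-cong f≗f′ g≗g′ n = sumTo-cong n (λ i → cong₂ _*_ (f≗f′ i) (g≗g′ (n ∸ i)))

  ⊗-comm : ∀ f g → f ⊗ g ≗ g ⊗ f
  ⊗-comm f g n = begin
    sumTo n (λ i → f i * g (n ∸ i))
      ≡⟨ sumTo-reverse n _ ⟩
    sumTo n (λ i → f (n ∸ i) * g (n ∸ (n ∸ i)))
      ≡⟨ sumTo-cong-≤ n (λ {i} i≤n → cong (λ j → f (n ∸ i) * g j) (ℕ.m∸[m∸n]≡n i≤n)) ⟩
    sumTo n (λ i → f (n ∸ i) * g i)
      ≡⟨ sumTo-cong n (λ i → *-comm (f (n ∸ i)) (g i)) ⟩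
    sumTo n (λ i → g i * f (n ∸ i))
      ∎
    where open ≡-Reasoning

  ⊗-assoc : ∀ f g h → (f ⊗ g) ⊗ h ≗ f ⊗ (g ⊗ h)
  ⊗-assoc f g h n = begin
    sumTo n (λ s → sumTo s (λ i → f i * g (s ∸ i)) * h (n ∸ s))
      ≡⟨ sumTo-cong n (λ s → *-sumToʳ s (h (n ∸ s)) _) ⟩
    sumTo n (λ s → sumTo s (λ i → f i * g (s ∸ i) * h (n ∸ s)))
      ≡⟨ sumTo-cong-≤ n (λ {s} _ → sumTo-cong-≤ s (λ {i} i≤s → reassociate i s i≤s)) ⟨
    sumTo n (λ s → sumTo s (λ i → f i * (g (s ∸ i) * h (n ∸ i ∸ (s ∸ i)))))
      ≡⟨ sumTo-triangle n (λ i j → f i * (g j * h (n ∸ i ∸ j))) ⟨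
    sumTo n (λ i → sumTo (n ∸ i) (λ j → f i * (g j * h (n ∸ i ∸ j))))
      ≡⟨ sumTo-cong n (λ i → *-sumToˡ (n ∸ i) (f i) _) ⟨
    sumTo n (λ i → f i * sumTo (n ∸ i) (λ j → g j * h (n ∸ i ∸ j)))
      ∎
    where
    open ≡-Reasoning
    reassociate : ∀ i s → i ≤ s → f i * (g (s ∸ i) * h (n ∸ i ∸ (s ∸ i))) ≡ f i * g (s ∸ i) * h (n ∸ s)
    reassociate i s i≤s = begin
      f i * (g (s ∸ i) * h (n ∸ i ∸ (s ∸ i))) ≡⟨ *-assoc (f i) _ _ ⟨
      f i * g (s ∸ i) * h (n ∸ i ∸ (s ∸ i))   ≡⟨ cong (λ j → f i * g (s ∸ i) * h j) (ℕ.∸-+-assoc n i (s ∸ i)) ⟩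
      f i * g (s ∸ i) * h (n ∸ (i ℕ.+ (s ∸ i))) ≡⟨ cong (λ j → f i * g (s ∸ i) * h (n ∸ j)) (ℕ.m+[n∸m]≡n i≤s) ⟩
      f i * g (s ∸ i) * h (n ∸ s)             ∎

  ⊗-·ʳ : ∀ c f g → f ⊗ (c · g) ≗ c · (f ⊗ g)
  ⊗-·ʳ c f g n = trans (sumTo-cong n (λ i → x∙yz≈y∙xz (f i) c (g (n ∸ i)))) (sym (*-sumToˡ n c _))

  θ : PS → PS
  θ f n = fromℕ n * f n

  θ-leibniz : ∀ f g n → θ (f ⊗ g) n ≡ (θ f ⊗ g) n + (f ⊗ θ g) n
  θ-leibniz f g n = begin
    fromℕ n * sumTo n (λ i → f i * g (n ∸ i))
      ≡⟨ *-sumToˡ n (fromℕ n) _ ⟩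
    sumTo n (λ i → fromℕ n * (f i * g (n ∸ i)))
      ≡⟨ sumTo-cong-≤ n split ⟩
    sumTo n (λ i → fromℕ i * f i * g (n ∸ i) + f i * (fromℕ (n ∸ i) * g (n ∸ i)))
      ≡⟨ sumTo-+ n _ _ ⟩
    (θ f ⊗ g) n + (f ⊗ θ g) n
      ∎
    where
    open ≡-Reasoning
    distrib : ∀ a b x y → (a + b) * (x * y) ≡ a * x * y + x * (b * y)
    distrib = solve 4 (λ a b x y → (a :+ b) :* (x :* y) := a :* x :* y :+ x :* (b :* y)) refl
    split : ∀ {i} → i ≤ n → fromℕ n * (f i * g (n ∸ i)) ≡ fromℕ i * f i * g (n ∸ i) + f i * (fromℕ (n ∸ i) * g (n ∸ i))
    split {i} i≤n = begin
      fromℕ n * (f i * g (n ∸ i))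
        ≡⟨ cong (λ j → fromℕ j * (f i * g (n ∸ i))) (ℕ.m+[n∸m]≡n i≤n) ⟨
      fromℕ (i ℕ.+ (n ∸ i)) * (f i * g (n ∸ i))
        ≡⟨ cong (_* (f i * g (n ∸ i))) (fromℕ-+ i (n ∸ i)) ⟩
      (fromℕ i + fromℕ (n ∸ i)) * (f i * g (n ∸ i))
        ≡⟨ distrib (fromℕ i) (fromℕ (n ∸ i)) (f i) (g (n ∸ i)) ⟩
      fromℕ i * f i * g (n ∸ i) + f i * (fromℕ (n ∸ i) * g (n ∸ i))
        ∎

  θ-onePS : ∀ n → θ onePS n ≡ 0ℚ
  θ-onePS zero    = refl
  θ-onePS (suc n) = *-zeroʳ (fromℕ (suc n))

  θ-powPS : ∀ f m → θ (powPS f (suc m)) ≗ fromℕ (suc m) · (θ f ⊗ powPS f m)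
  θ-powPS f zero n = begin
    θ (f ⊗ onePS) n                          ≡⟨ θ-leibniz f onePS n ⟩
    (θ f ⊗ onePS) n + (f ⊗ θ onePS) n        ≡⟨ cong ((θ f ⊗ onePS) n +_) (sumTo-zero n (λ {i} _ → θ1≡0 i)) ⟩
    (θ f ⊗ onePS) n + 0ℚ                     ≡⟨ +-identityʳ _ ⟩
    (θ f ⊗ onePS) n                          ≡⟨ *-identityˡ _ ⟨
    1ℚ * (θ f ⊗ onePS) n                     ∎
    where
    open ≡-Reasoning
    θ1≡0 : ∀ i → f i * θ onePS (n ∸ i) ≡ 0ℚ
    θ1≡0 i = trans (cong (f i *_) (θ-onePS (n ∸ i))) (*-zeroʳ (f i))
  θ-powPS f (suc m) n = begin
    θ (f ⊗ P) n
      ≡⟨ θ-leibniz f P n ⟩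
    (θ f ⊗ P) n + (f ⊗ θ P) n
      ≡⟨ cong ((θ f ⊗ P) n +_) (⊗-cong {f} {f} (λ _ → refl) (θ-powPS f m) n) ⟩
    (θ f ⊗ P) n + (f ⊗ (c · (θ f ⊗ P′))) n
      ≡⟨ cong ((θ f ⊗ P) n +_) (⊗-·ʳ c f (θ f ⊗ P′) n) ⟩
    (θ f ⊗ P) n + c * (f ⊗ (θ f ⊗ P′)) n
      ≡⟨ cong (λ x → (θ f ⊗ P) n + c * x) (⊗-left-comm n) ⟩
    (θ f ⊗ P) n + c * (θ f ⊗ P) n
      ≡⟨ cong (_+ c * (θ f ⊗ P) n) (*-identityˡ ((θ f ⊗ P) n)) ⟨
    1ℚ * (θ f ⊗ P) n + c * (θ f ⊗ P) n
      ≡⟨ *-distribʳ-+ ((θ f ⊗ P) n) 1ℚ c ⟨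
    (1ℚ + c) * (θ f ⊗ P) n
      ≡⟨ cong (_* (θ f ⊗ P) n) (fromℕ-+ 1 (suc m)) ⟨
    fromℕ (suc (suc m)) * (θ f ⊗ P) n
      ∎
    where
    open ≡-Reasoning
    P′ = powPS f m
    P = powPS f (suc m)
    c = fromℕ (suc m)
    ⊗-left-comm : f ⊗ (θ f ⊗ P′) ≗ θ f ⊗ P
    ⊗-left-comm n = begin
      (f ⊗ (θ f ⊗ P′)) n  ≡⟨ ⊗-assoc f (θ f) P′ n ⟨
      ((f ⊗ θ f) ⊗ P′) n  ≡⟨ ⊗-cong {g = P′} {g′ = P′} (⊗-comm f (θ f)) (λ _ → refl) n ⟩
      ((θ f ⊗ f) ⊗ P′) n  ≡⟨ ⊗-assoc (θ f) f P′ n ⟩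
      (θ f ⊗ P) n         ∎

  powPS-vanish : ∀ f → f 0 ≡ 0ℚ → ∀ m {j} → j < m → powPS f m j ≡ 0ℚ
  powPS-vanish f f0≡0 (suc m) {j} j<1+m = sumTo-zero j term≡0
    where
    term≡0 : ∀ {i} → i ≤ j → f i * powPS f m (j ∸ i) ≡ 0ℚ
    term≡0 {zero}  _   = trans (cong (_* powPS f m j) f0≡0) (*-zeroˡ (powPS f m j))
    term≡0 {suc i} i<j = trans (cong (f (suc i) *_) (powPS-vanish f f0≡0 m j∸i<m)) (*-zeroʳ (f (suc i)))
      where
      j∸i<m : j ∸ suc i < m
      j∸i<m = ℕ.<-≤-trans (ℕ.∸-monoʳ-< {j} {suc i} {0} (s≤s z≤n) i<j) (ℕ.≤-pred j<1+m)

  inv! : ℕ → ℚ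
  inv! m = (ℤ.+ 1 / m !) {{m ℕ.!≢0}}

  fromℕ-*-inv! : ∀ m → fromℕ (suc m) * inv! (suc m) ≡ inv! m
  fromℕ-*-inv! m = *-cancelʳ-fromℕ (m !) {{m ℕ.!≢0}} (begin
    fromℕ (suc m) * inv! (suc m) * fromℕ (m !)    ≡⟨ xy∙z≈y∙xz (fromℕ (suc m)) (inv! (suc m)) (fromℕ (m !)) ⟩
    inv! (suc m) * (fromℕ (suc m) * fromℕ (m !))  ≡⟨ cong (inv! (suc m) *_) (fromℕ-* (suc m) (m !)) ⟨
    inv! (suc m) * fromℕ (suc m !)                ≡⟨ /-*-fromℕ 1 (suc m !) {{suc m ℕ.!≢0}} ⟩
    fromℕ 1                                       ≡⟨ /-*-fromℕ 1 (m !) {{m ℕ.!≢0}} ⟨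
    inv! m * fromℕ (m !)                          ∎)
    where open ≡-Reasoning

  expPS-extend : ∀ f → f 0 ≡ 0ℚ → ∀ {j N} → j ≤ N → expPS f j ≡ sumTo N (λ m → powPS f m j * inv! m)
  expPS-extend f f0≡0 j≤N = sym (sumTo-extend _ j≤N (λ {m} j<m →
    trans (cong (_* inv! m) (powPS-vanish f f0≡0 m j<m)) (*-zeroˡ (inv! m))))

  ⊗-expPS : ∀ f g → f 0 ≡ 0ℚ → ∀ n → (g ⊗ expPS f) n ≡ sumTo n (λ m → (g ⊗ powPS f m) n * inv! m)
  ⊗-expPS f g f0≡0 n = begin
    sumTo n (λ i → g i * expPS f (n ∸ i))
      ≡⟨ sumTo-cong n (λ i → cong (g i *_) (expPS-extend f f0≡0 (ℕ.m∸n≤m n i))) ⟩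
    sumTo n (λ i → g i * sumTo n (λ m → P m (n ∸ i) * inv! m))
      ≡⟨ sumTo-cong n (λ i → *-sumToˡ n (g i) _) ⟩
    sumTo n (λ i → sumTo n (λ m → g i * (P m (n ∸ i) * inv! m)))
      ≡⟨ sumTo-swap n n _ ⟩
    sumTo n (λ m → sumTo n (λ i → g i * (P m (n ∸ i) * inv! m)))
      ≡⟨ sumTo-cong n (λ m → sumTo-cong n (λ i → *-assoc (g i) (P m (n ∸ i)) (inv! m))) ⟨
    sumTo n (λ m → sumTo n (λ i → g i * P m (n ∸ i) * inv! m))
      ≡⟨ sumTo-cong n (λ m → *-sumToʳ n (inv! m) _) ⟨
    sumTo n (λ m → (g ⊗ P m) n * inv! m)
      ∎
    where
    open ≡-Reasoning
    P = powPS f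

  θ-expPS : ∀ f → f 0 ≡ 0ℚ → θ (expPS f) ≗ θ f ⊗ expPS f
  θ-expPS f f0≡0 n = begin
    fromℕ n * expPS f n
      ≡⟨ cong (fromℕ n *_) (expPS-extend f f0≡0 (ℕ.n≤1+n n)) ⟩
    fromℕ n * sumTo (suc n) (λ m → P m n * inv! m)
      ≡⟨ *-sumToˡ (suc n) (fromℕ n) _ ⟩
    sumTo (suc n) (λ m → fromℕ n * (P m n * inv! m))
      ≡⟨ sumTo-cong (suc n) (λ m → *-assoc (fromℕ n) (P m n) (inv! m)) ⟨
    sumTo (suc n) (λ m → θ (P m) n * inv! m)
      ≡⟨ sumTo-shift n _ ⟩
    θ onePS n * inv! 0 + sumTo n (λ m → θ (P (suc m)) n * inv! (suc m))
      ≡⟨ cong₂ _+_ (trans (cong (_* inv! 0) (θ-onePS n)) (*-zeroˡ (inv! 0))) (sumTo-cong n term) ⟩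
    0ℚ + sumTo n (λ m → (θ f ⊗ P m) n * inv! m)
      ≡⟨ +-identityˡ _ ⟩
    sumTo n (λ m → (θ f ⊗ P m) n * inv! m)
      ≡⟨ ⊗-expPS f (θ f) f0≡0 n ⟨
    (θ f ⊗ expPS f) n
      ∎
    where
    open ≡-Reasoning
    P = powPS f
    term : ∀ m → θ (P (suc m)) n * inv! (suc m) ≡ (θ f ⊗ P m) n * inv! m
    term m = begin
      θ (P (suc m)) n * inv! (suc m)      ≡⟨ cong (_* inv! (suc m)) (θ-powPS f m n) ⟩
      fromℕ (suc m) * X * inv! (suc m)    ≡⟨ xy∙z≈y∙xz (fromℕ (suc m)) X (inv! (suc m)) ⟩
      X * (fromℕ (suc m) * inv! (suc m))  ≡⟨ cong (X *_) (fromℕ-*-inv! m) ⟩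
      X * inv! m                          ∎
      where X = (θ f ⊗ P m) n

  θ-ode-unique : ∀ g u v → g 0 ≡ 0ℚ → θ u ≗ g ⊗ u → θ v ≗ g ⊗ v → u 0 ≡ v 0 → u ≗ v
  θ-ode-unique g u v g0≡0 θu θv u0≡v0 n = agree n ℕ.≤-refl
    where
    agree : ∀ n {j} → j ≤ n → u j ≡ v j
    agree zero    z≤n = u0≡v0
    agree (suc n) j≤1+n with ℕ.m≤n⇒m<n∨m≡n j≤1+n
    ... | inj₁ j<1+n = agree n (ℕ.≤-pred j<1+n)
    ... | inj₂ refl  = *-cancelʳ-fromℕ (suc n) (begin
      u (suc n) * fromℕ (suc n)      ≡⟨ *-comm (u (suc n)) (fromℕ (suc n)) ⟩
      θ u (suc n)                    ≡⟨ θu (suc n) ⟩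
      (g ⊗ u) (suc n)                ≡⟨ sumTo-cong (suc n) same-terms ⟩
      (g ⊗ v) (suc n)                ≡⟨ θv (suc n) ⟨
      θ v (suc n)                    ≡⟨ *-comm (fromℕ (suc n)) (v (suc n)) ⟩
      v (suc n) * fromℕ (suc n)      ∎)
      where
      open ≡-Reasoning
      same-terms : ∀ i → g i * u (suc n ∸ i) ≡ g i * v (suc n ∸ i)
      same-terms zero    = begin
        g 0 * u (suc n)  ≡⟨ cong (_* u (suc n)) g0≡0 ⟩
        0ℚ * u (suc n)   ≡⟨ *-zeroˡ (u (suc n)) ⟩
        0ℚ               ≡⟨ *-zeroˡ (v (suc n)) ⟨
        0ℚ * v (suc n)   ≡⟨ cong (_* v (suc n)) g0≡0 ⟨
        g 0 * v (suc n)  ∎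
      same-terms (suc i) = cong (g (suc i) *_) (agree n (ℕ.m∸n≤m n i))

module Alphabets where

  open import Data.Nat as ℕ using (ℕ; zero; suc; _+_; _*_; _≤_; _<_; _≟_)
  import Data.Nat.Properties as ℕ
  open import Data.Nat.ListAction using (sum)
  open import Data.Nat.ListAction.Properties using (sum-↭)
  open import Data.Bool using (true; false; if_then_else_; not)
  open import Data.List using (List; []; _∷_; map; filter; length)
  import Data.List.Properties as List
  open import Data.List.Membership.Propositional using (_∈_)
  open import Data.List.Relation.Unary.Any using (here; there)
  import Relation.Unary
  open import Data.List.Relation.Unary.All as All using (All; []; _∷_)
  import Data.List.Relation.Unary.All.Properties as All
  open import Data.List.Relation.Binary.Permutation.Propositional
    using (_↭_; ↭-prep; ↭-swap; ↭-refl; ↭-reflexive; module PermutationReasoning)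
  import Data.List.Relation.Binary.Permutation.Propositional.Properties as ↭
  open import Data.List.Relation.Unary.Unique.Propositional using (Unique; []; _∷_)
  import Data.List.Relation.Unary.Unique.Propositional.Properties as Unique
  import Data.List.Membership.Propositional.Properties as ∈
  open import Data.Product using (_×_; _,_)
  open import Function using (_∘_)
  open import Relation.Nullary using (does; ¬?; yes; no)
  open import Relation.Binary.PropositionalEquality
  open import Algebra.Properties.CommutativeSemigroup ℕ.+-commutativeSemigroup using (interchange)

  ∑ : List ℕ → (ℕ → ℕ) → ℕ
  ∑ A f = sum (map f A)

  syntax ∑ A (λ x → e) = ∑[ x ∈ A ] e

  remove : ℕ → List ℕ → List ℕ
  remove x = filter (¬? ∘ (x ≟_))

  ∑-cong : ∀ A {f g : ℕ → ℕ} → (∀ {x} → x ∈ A → f x ≡ g x) → ∑ A f ≡ ∑ A g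
  ∑-cong A f≡g = cong sum (List.map-cong-local (All.tabulate f≡g))

  ∑-zero : ∀ A {f : ℕ → ℕ} → (∀ x → f x ≡ 0) → ∑ A f ≡ 0
  ∑-zero []      f≡0 = refl
  ∑-zero (x ∷ A) f≡0 = cong₂ _+_ (f≡0 x) (∑-zero A f≡0)

  ∑-+ : ∀ A (f g : ℕ → ℕ) → ∑[ x ∈ A ] (f x + g x) ≡ ∑ A f + ∑ A g
  ∑-+ []      f g = refl
  ∑-+ (x ∷ A) f g = trans (cong (f x + g x +_) (∑-+ A f g)) (interchange (f x) (g x) (∑ A f) (∑ A g))

  ∑-swap : ∀ A B (G : ℕ → ℕ → ℕ) → ∑[ x ∈ A ] ∑ B (G x) ≡ ∑[ y ∈ B ] ∑[ x ∈ A ] G x y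
  ∑-swap []      B G = sym (∑-zero B (λ _ → refl))
  ∑-swap (x ∷ A) B G = trans (cong (∑ B (G x) +_) (∑-swap A B G)) (sym (∑-+ B (G x) _))

  ∑-filter : ∀ {P : ℕ → Set} (P? : Relation.Unary.Decidable P) A f →
             ∑ (filter P? A) f ≡ ∑[ x ∈ A ] (if does (P? x) then f x else 0)
  ∑-filter P? []      f = refl
  ∑-filter P? (x ∷ A) f with does (P? x)
  ... | true  = cong (f x +_) (∑-filter P? A f)
  ... | false = ∑-filter P? A f

  ∑-const : ∀ A {f : ℕ → ℕ} {c} → (∀ {x} → x ∈ A → f x ≡ c) → ∑ A f ≡ length A * c
  ∑-const []      f≡c = refl
  ∑-const (x ∷ A) f≡c = cong₂ _+_ (f≡c (here refl)) (∑-const A (f≡c ∘ there))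

  ∑-↭ : ∀ {A B} (f : ℕ → ℕ) → A ↭ B → ∑ A f ≡ ∑ B f
  ∑-↭ f A↭B = sum-↭ (↭.map⁺ f A↭B)

  All-remove : ∀ {R : ℕ → Set} x {A} → All R A → All R (remove x A)
  All-remove x = All.filter⁺ (¬? ∘ (x ≟_))

  Unique-remove : ∀ x {A} → Unique A → Unique (remove x A)
  Unique-remove x = Unique.filter⁺ (¬? ∘ (x ≟_))

  ∈-remove⁺ : ∀ {x y A} → y ∈ A → x ≢ y → y ∈ remove x A
  ∈-remove⁺ {x} = ∈.∈-filter⁺ (¬? ∘ (x ≟_))

  ∈-remove⁻ : ∀ {x y A} → y ∈ remove x A → y ∈ A × x ≢ y
  ∈-remove⁻ {x} = ∈.∈-filter⁻ (¬? ∘ (x ≟_))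

  remove-min : ∀ {m A} → All (m ≤_) A → All (m <_) (remove m A)
  remove-min {m} {A} m≤A =
    All.zipWith (λ (m≤x , m≢x) → ℕ.≤∧≢⇒< m≤x m≢x) (All-remove m m≤A , All.all-filter (¬? ∘ (m ≟_)) A)

  remove-self : ∀ x A → remove x (x ∷ A) ≡ remove x A
  remove-self x A = List.filter-reject (¬? ∘ (x ≟_)) (λ x≢x → x≢x refl)

  remove-other : ∀ {x y} A → x ≢ y → remove x (y ∷ A) ≡ y ∷ remove x A
  remove-other {x} A x≢y = List.filter-accept (¬? ∘ (x ≟_)) x≢y

  remove-↭ : ∀ {x A} → Unique A → x ∈ A → A ↭ x ∷ remove x A
  remove-↭ {x} {_ ∷ A} (x∉A ∷ _) (here refl) =
    ↭-prep x (↭-reflexive (sym (trans (remove-self x A) (List.filter-all (¬? ∘ (x ≟_)) x∉A))))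
  remove-↭ {x} {y ∷ A} (y∉A ∷ uA) (there x∈A) = begin
    y ∷ A                    ↭⟨ ↭-prep y (remove-↭ uA x∈A) ⟩
    y ∷ x ∷ remove x A       ↭⟨ ↭-swap y x ↭-refl ⟩
    x ∷ y ∷ remove x A       ≡⟨ cong (x ∷_) (remove-other A (λ x≡y → All.lookup y∉A x∈A (sym x≡y))) ⟨
    x ∷ remove x (y ∷ A)     ∎
    where open PermutationReasoning

  length-remove : ∀ {x A l} → Unique A → x ∈ A → length A ≡ suc l → length (remove x A) ≡ l
  length-remove uA x∈A len = ℕ.suc-injective (trans (sym (↭.↭-length (remove-↭ uA x∈A))) len)

  ∑-remove : ∀ {x A} (f : ℕ → ℕ) → Unique A → x ∈ A → ∑ A f ≡ f x + ∑ (remove x A) f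
  ∑-remove f uA x∈A = ∑-↭ f (remove-↭ uA x∈A)

  remove-comm : ∀ x y A → remove y (remove x A) ≡ remove x (remove y A)
  remove-comm x y []      = refl
  remove-comm x y (z ∷ A) with x ≟ z | y ≟ z
  ... | yes refl | yes refl = refl
  ... | yes refl | no y≢x   = begin
    remove y (remove x (x ∷ A))  ≡⟨ cong (remove y) (remove-self x A) ⟩
    remove y (remove x A)        ≡⟨ remove-comm x y A ⟩
    remove x (remove y A)        ≡⟨ remove-self x (remove y A) ⟨
    remove x (x ∷ remove y A)    ≡⟨ cong (remove x) (remove-other A y≢x) ⟨
    remove x (remove y (x ∷ A))  ∎
    where open ≡-Reasoning
  ... | no x≢y   | yes refl = begin
    remove y (remove x (y ∷ A))  ≡⟨ cong (remove y) (remove-other A x≢y) ⟩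
    remove y (y ∷ remove x A)    ≡⟨ remove-self y (remove x A) ⟩
    remove y (remove x A)        ≡⟨ remove-comm x y A ⟩
    remove x (remove y A)        ≡⟨ cong (remove x) (remove-self y A) ⟨
    remove x (remove y (y ∷ A))  ∎
    where open ≡-Reasoning
  ... | no x≢z   | no y≢z   = begin
    remove y (remove x (z ∷ A))  ≡⟨ cong (remove y) (remove-other A x≢z) ⟩
    remove y (z ∷ remove x A)    ≡⟨ remove-other (remove x A) y≢z ⟩
    z ∷ remove y (remove x A)    ≡⟨ cong (z ∷_) (remove-comm x y A) ⟩
    z ∷ remove x (remove y A)    ≡⟨ remove-other (remove y A) x≢z ⟨
    remove x (z ∷ remove y A)    ≡⟨ cong (remove x) (remove-other A y≢z) ⟨
    remove x (remove y (z ∷ A))  ∎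
    where open ≡-Reasoning

  does-≟-sym : ∀ x y → does (x ≟ y) ≡ does (y ≟ x)
  does-≟-sym zero    zero    = refl
  does-≟-sym zero    (suc y) = refl
  does-≟-sym (suc x) zero    = refl
  does-≟-sym (suc x) (suc y) = does-≟-sym x y

  ∑-swap-remove : ∀ A (G : ℕ → ℕ → ℕ) →
                  ∑[ x ∈ A ] ∑[ y ∈ remove x A ] G x y ≡ ∑[ y ∈ A ] ∑[ x ∈ remove y A ] G x y
  ∑-swap-remove A G = begin
    ∑[ x ∈ A ] ∑[ y ∈ remove x A ] G x y
      ≡⟨ ∑-cong A (λ {x} _ → ∑-filter (¬? ∘ (x ≟_)) A (G x)) ⟩
    ∑[ x ∈ A ] ∑[ y ∈ A ] (if not (does (x ≟ y)) then G x y else 0)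
      ≡⟨ ∑-swap A A _ ⟩
    ∑[ y ∈ A ] ∑[ x ∈ A ] (if not (does (x ≟ y)) then G x y else 0)
      ≡⟨ ∑-cong A (λ {y} _ → ∑-cong A (λ {x} _ → cong (λ b → if not b then G x y else 0) (does-≟-sym x y))) ⟩
    ∑[ y ∈ A ] ∑[ x ∈ A ] (if not (does (y ≟ x)) then G x y else 0)
      ≡⟨ ∑-cong A (λ {y} _ → ∑-filter (¬? ∘ (y ≟_)) A (λ x → G x y)) ⟨
    ∑[ y ∈ A ] ∑[ x ∈ remove y A ] G x y
      ∎
    where open ≡-Reasoning

module Arrangements where

  open import Data.Nat as ℕ using (ℕ; zero; suc; _+_; _≡ᵇ_; _≟_)
  open import Data.Bool using (Bool; true; false; if_then_else_; not; _∧_; T?)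
  import Data.Bool.Properties as Bool
  open import Data.Bool.ListAction using (any)
  open import Data.List using (List; []; _∷_; [_]; map; concatMap; filterᵇ; length; upTo; _++_; _∷ʳ_)
  import Data.List.Properties as List
  open import Data.List.Relation.Unary.All as All using (All; []; _∷_)
  open import Data.Unit using (tt)
  open import Function using (_∘_)
  open import Relation.Nullary using (does; ¬?)
  open import Relation.Binary.PropositionalEquality hiding ([_])
  open Alphabets

  #arrangements : ℕ → (List ℕ → Bool) → List ℕ → ℕ
  #arrangements zero    P A = if P [] then 1 else 0
  #arrangements (suc l) P A = ∑[ x ∈ A ] #arrangements l (λ w → P (x ∷ w)) (remove x A)

  #arrangements-cong-All : ∀ {R : ℕ → Set} l {P Q : List ℕ → Bool} A → All R A →
                           (∀ {w} → All R w → P w ≡ Q w) → #arrangements l P A ≡ #arrangements l Q A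
  #arrangements-cong-All zero    A _  P≡Q = cong (λ b → if b then 1 else 0) (P≡Q [])
  #arrangements-cong-All (suc l) A RA P≡Q = ∑-cong A (λ {x} x∈A →
    #arrangements-cong-All l (remove x A) (All-remove x RA) (λ Rw → P≡Q (All.lookup RA x∈A ∷ Rw)))

  #arrangements-cong : ∀ l {P Q : List ℕ → Bool} A → (∀ w → P w ≡ Q w) → #arrangements l P A ≡ #arrangements l Q A
  #arrangements-cong l A P≗Q = #arrangements-cong-All l A (All.universal (λ _ → tt) A) (λ {w} _ → P≗Q w)

  #arrangements-false : ∀ l A → #arrangements l (λ _ → false) A ≡ 0
  #arrangements-false zero    A = refl
  #arrangements-false (suc l) A = ∑-zero A (λ x → #arrangements-false l (remove x A))

  #arrangements-last : ∀ l P A → #arrangements (suc l) P A ≡ ∑[ x ∈ A ] #arrangements l (λ w → P (w ∷ʳ x)) (remove x A)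
  #arrangements-last zero    P A = refl
  #arrangements-last (suc l) P A = begin
    ∑[ x ∈ A ] #arrangements (suc l) (λ w → P (x ∷ w)) (remove x A)
      ≡⟨ ∑-cong A (λ {x} _ → #arrangements-last l (λ w → P (x ∷ w)) (remove x A)) ⟩
    ∑[ x ∈ A ] ∑[ y ∈ remove x A ] #arrangements l (λ w → P (x ∷ w ∷ʳ y)) (remove y (remove x A))
      ≡⟨ ∑-swap-remove A (λ x y → #arrangements l (λ w → P (x ∷ w ∷ʳ y)) (remove y (remove x A))) ⟩
    ∑[ y ∈ A ] ∑[ x ∈ remove y A ] #arrangements l (λ w → P (x ∷ w ∷ʳ y)) (remove y (remove x A))
      ≡⟨ ∑-cong A (λ {y} _ → ∑-cong (remove y A) (λ {x} _ → cong (#arrangements l _) (remove-comm x y A))) ⟩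
    ∑[ y ∈ A ] #arrangements (suc l) (λ w → P (w ∷ʳ y)) (remove y A)
      ∎
    where open ≡-Reasoning

  count : (List ℕ → Bool) → List (List ℕ) → ℕ
  count P ws = length (filterᵇ P ws)

  count-cong : ∀ {P Q : List ℕ → Bool} ws → (∀ w → P w ≡ Q w) → count P ws ≡ count Q ws
  count-cong []       _   = refl
  count-cong {P} {Q} (w ∷ ws) P≗Q rewrite P≗Q w with Q w
  ... | true  = cong suc (count-cong ws P≗Q)
  ... | false = count-cong ws P≗Q

  count-false : ∀ ws → count (λ _ → false) ws ≡ 0
  count-false []       = refl
  count-false (_ ∷ ws) = count-false ws

  count-map-∷ : ∀ P x ws → count P (map (x ∷_) ws) ≡ count (λ w → P (x ∷ w)) ws
  count-map-∷ P x []       = refl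
  count-map-∷ P x (w ∷ ws) with P (x ∷ w)
  ... | true  = cong suc (count-map-∷ P x ws)
  ... | false = count-map-∷ P x ws

  count-concatMap : ∀ P (g : ℕ → List (List ℕ)) A → count P (concatMap g A) ≡ ∑[ x ∈ A ] count P (g x)
  count-concatMap P g []      = refl
  count-concatMap P g (x ∷ A) = begin
    length (filterᵇ P (g x ++ concatMap g A))                ≡⟨ cong length (List.filter-++ (T? ∘ P) (g x) (concatMap g A)) ⟩
    length (filterᵇ P (g x) ++ filterᵇ P (concatMap g A))    ≡⟨ List.length-++ (filterᵇ P (g x)) ⟩
    count P (g x) + count P (concatMap g A)                  ≡⟨ cong (count P (g x) +_) (count-concatMap P g A) ⟩
    count P (g x) + ∑[ y ∈ A ] count P (g y)                 ∎
    where open ≡-Reasoning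

  filterᵇ-filterᵇ : ∀ (P Q : List ℕ → Bool) ws → filterᵇ Q (filterᵇ P ws) ≡ filterᵇ (λ w → P w ∧ Q w) ws
  filterᵇ-filterᵇ P Q []       = refl
  filterᵇ-filterᵇ P Q (w ∷ ws) with P w
  ... | false = filterᵇ-filterᵇ P Q ws
  ... | true with Q w
  ...   | true  = cong (w ∷_) (filterᵇ-filterᵇ P Q ws)
  ...   | false = filterᵇ-filterᵇ P Q ws

  wordsOver : List ℕ → ℕ → List (List ℕ)
  wordsOver A zero    = [ [] ]
  wordsOver A (suc l) = concatMap (λ x → map (x ∷_) (wordsOver A l)) A

  words≡wordsOver : ∀ a l → words a l ≡ wordsOver (upTo a) l
  words≡wordsOver a zero    = refl
  words≡wordsOver a (suc l) = cong (λ W → concatMap (λ x → map (x ∷_) W) (upTo a)) (words≡wordsOver a l)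

  count-wordsOver : ∀ P A l → count P (wordsOver A (suc l)) ≡ ∑[ x ∈ A ] count (λ w → P (x ∷ w)) (wordsOver A l)
  count-wordsOver P A l = trans (count-concatMap P _ A) (∑-cong A (λ {x} _ → count-map-∷ P x (wordsOver A l)))

  count-avoiding : ∀ x A l Q →
                   count (λ w → not (any (x ≡ᵇ_) w) ∧ Q w) (wordsOver A l) ≡ count Q (wordsOver (remove x A) l)
  count-avoiding x A zero    Q with Q []
  ... | true  = refl
  ... | false = refl
  count-avoiding x A (suc l) Q = begin
    count (λ w → not (any (x ≡ᵇ_) w) ∧ Q w) (wordsOver A (suc l))
      ≡⟨ count-wordsOver _ A l ⟩
    ∑[ y ∈ A ] count (λ w → not (any (x ≡ᵇ_) (y ∷ w)) ∧ Q (y ∷ w)) (wordsOver A l)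
      ≡⟨ ∑-cong A (λ {y} _ → first-letter y) ⟩
    ∑[ y ∈ A ] (if not (does (x ≟ y)) then count (λ w → Q (y ∷ w)) (wordsOver (remove x A) l) else 0)
      ≡⟨ ∑-filter (¬? ∘ (x ≟_)) A _ ⟨
    ∑[ y ∈ remove x A ] count (λ w → Q (y ∷ w)) (wordsOver (remove x A) l)
      ≡⟨ count-wordsOver Q (remove x A) l ⟨
    count Q (wordsOver (remove x A) (suc l))
      ∎
    where
    open ≡-Reasoning
    first-letter : ∀ y → count (λ w → not (any (x ≡ᵇ_) (y ∷ w)) ∧ Q (y ∷ w)) (wordsOver A l)
                       ≡ (if not (does (x ≟ y)) then count (λ w → Q (y ∷ w)) (wordsOver (remove x A) l) else 0)
    first-letter y with x ≡ᵇ y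
    ... | true  = count-false (wordsOver A l)
    ... | false = count-avoiding x A l (λ w → Q (y ∷ w))

  count-distinct : ∀ l P A → count (λ w → distinct w ∧ P w) (wordsOver A l) ≡ #arrangements l P A
  count-distinct zero    P A with P []
  ... | true  = refl
  ... | false = refl
  count-distinct (suc l) P A = trans (count-wordsOver _ A l) (∑-cong A (λ {x} _ → begin
    count (λ w → distinct (x ∷ w) ∧ P (x ∷ w)) (wordsOver A l)
      ≡⟨ count-cong (wordsOver A l) (λ w → Bool.∧-assoc (not (any (x ≡ᵇ_) w)) (distinct w) (P (x ∷ w))) ⟩
    count (λ w → not (any (x ≡ᵇ_) w) ∧ (distinct w ∧ P (x ∷ w))) (wordsOver A l)
      ≡⟨ count-avoiding x A l _ ⟩
    count (λ w → distinct w ∧ P (x ∷ w)) (wordsOver (remove x A) l)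
      ≡⟨ count-distinct l (λ w → P (x ∷ w)) (remove x A) ⟩
    #arrangements l (λ w → P (x ∷ w)) (remove x A)
      ∎))
    where open ≡-Reasoning

  count-perms : ∀ P n → length (filterᵇ P (perms n)) ≡ #arrangements n P (upTo n)
  count-perms P n = begin
    length (filterᵇ P (filterᵇ distinct (words n n)))           ≡⟨ cong length (filterᵇ-filterᵇ distinct P (words n n)) ⟩
    count (λ w → distinct w ∧ P w) (words n n)                  ≡⟨ cong (count _) (words≡wordsOver n n) ⟩
    count (λ w → distinct w ∧ P w) (wordsOver (upTo n) n)       ≡⟨ count-distinct n P (upTo n) ⟩
    #arrangements n P (upTo n)                                  ∎
    where open ≡-Reasoning

module PatternOccurrence where

  open import Data.Nat as ℕ using (ℕ; zero; suc; _+_; _∸_; _≤_; _<_; _≤?_; _<ᵇ_; _≤ᵇ_; s≤s)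
  import Data.Nat.Properties as ℕ
  open import Data.Bool using (Bool; T; not; _∧_)
  open import Data.Bool.ListAction using (any; all)
  open import Data.Bool.Properties using (T-∧)
  open import Data.List using (List; []; _∷_; length; _++_; upTo)
  import Data.List.Properties as List
  open import Data.List.Relation.Unary.All as All using (All; []; _∷_)
  import Data.List.Relation.Unary.All.Properties as All
  import Data.List.Relation.Unary.Any.Properties as Any
  open import Data.Product using (_×_; _,_)
  open import Data.Sum using (_⊎_; inj₁; inj₂; [_,_])
  open import Function using (_∘_; id; _⇔_; mk⇔; Equivalence)
  open import Relation.Nullary using (¬_; contradiction; yes; no)
  open import Relation.Nullary.Reflects using (Reflects; ofʸ; ofⁿ; fromEquivalence; det; ¬-reflects; _×-reflects_)
  open import Relation.Binary.PropositionalEquality hiding ([_])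

  record Occurrence (k : ℕ) (π : List ℕ) : Set where
    constructor occurrence
    field
      {i j}  : ℕ
      i<j    : i < j
      fits   : j + k ≤ length π
      rises  : ∀ {t} → t < k → at π i < at π (j + t)

  module _ {k : ℕ} (1≤k : 1 ≤ k) where

    private
      risesᵇ : List ℕ → ℕ → ℕ → Bool
      risesᵇ π i j = all (λ t → at π i <ᵇ at π (j + t)) (upTo k)

      windowᵇ : List ℕ → ℕ → ℕ → Bool
      windowᵇ π i j = (i <ᵇ j) ∧ ((j + k) ≤ᵇ length π) ∧ risesᵇ π i j

    occurs⇒Occurrence : ∀ π → T (occurs k π) → Occurrence k π
    occurs⇒Occurrence π t =
      let i , _ , tᵢ = Any.applyUpTo⁻ id (Any.any⁻ (λ i → any (windowᵇ π i) (upTo n)) (upTo n) t)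
          j , _ , tⱼ = Any.applyUpTo⁻ id (Any.any⁻ (windowᵇ π i) (upTo n) tᵢ)
          i<ᵇj , rest = Equivalence.to T-∧ tⱼ
          fitsᵇ , risesᵇ = Equivalence.to T-∧ rest
      in occurrence (ℕ.<ᵇ⇒< i j i<ᵇj) (ℕ.≤ᵇ⇒≤ (j + k) n fitsᵇ)
                    (λ t<k → ℕ.<ᵇ⇒< _ _ (All.applyUpTo⁻ id k (All.all⁺ _ (upTo k) risesᵇ) t<k))
      where n = length π

    Occurrence⇒occurs : ∀ π → Occurrence k π → T (occurs k π)
    Occurrence⇒occurs π (occurrence {i} {j} i<j fits rises) =
      Any.any⁺ _ (Any.applyUpTo⁺ id (Any.any⁺ (windowᵇ π i) (Any.applyUpTo⁺ id window j<n)) (ℕ.<-trans i<j j<n))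
      where
      j<n : j < length π
      j<n = ℕ.<-≤-trans (ℕ.m<m+n j 1≤k) fits
      window : T (windowᵇ π i j)
      window = Equivalence.from T-∧ (ℕ.<⇒<ᵇ i<j , Equivalence.from T-∧ (ℕ.≤⇒≤ᵇ fits ,
                 All.all⁻ _ (All.applyUpTo⁺₁ id k (ℕ.<⇒<ᵇ ∘ rises))))

    occurs-reflects : ∀ π → Reflects (Occurrence k π) (occurs k π)
    occurs-reflects π = fromEquivalence (occurs⇒Occurrence π) (Occurrence⇒occurs π)

  at-++ˡ : ∀ σ τ {i} → i < length σ → at (σ ++ τ) i ≡ at σ i
  at-++ˡ (x ∷ σ) τ {zero}  _         = refl
  at-++ˡ (x ∷ σ) τ {suc i} (s≤s i<n) = at-++ˡ σ τ i<n

  at-++ʳ : ∀ σ τ i → at (σ ++ τ) (length σ + i) ≡ at τ i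
  at-++ʳ []      τ i = refl
  at-++ʳ (x ∷ σ) τ i = at-++ʳ σ τ i

  at-++-length : ∀ σ x τ → at (σ ++ x ∷ τ) (length σ) ≡ x
  at-++-length []      x τ = refl
  at-++-length (_ ∷ σ) x τ = at-++-length σ x τ

  at-All : ∀ {P : ℕ → Set} {w i} → All P w → i < length w → P (at w i)
  at-All {i = zero}  (px ∷ _)  _         = px
  at-All {i = suc i} (_  ∷ pw) (s≤s i<n) = at-All pw i<n

  Occurrence-++ˡ : ∀ {k} σ τ → Occurrence k σ → Occurrence k (σ ++ τ)
  Occurrence-++ˡ σ τ (occurrence {i} {j} i<j fits rises) =
    occurrence i<j (ℕ.≤-trans fits (List.length-++-≤ˡ σ)) (λ {t} t<k →
      subst₂ _<_ (sym (at-++ˡ σ τ (ℕ.<-≤-trans i<j (ℕ.≤-trans (ℕ.m≤m+n j _) fits))))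
                 (sym (at-++ˡ σ τ (ℕ.<-≤-trans (ℕ.+-monoʳ-< j t<k) fits)))
                 (rises t<k))

  Occurrence-++⁻ : ∀ {k} σ τ {i j} → i < j → j + k ≤ length σ →
                   (∀ {t} → t < k → at (σ ++ τ) i < at (σ ++ τ) (j + t)) → Occurrence k σ
  Occurrence-++⁻ σ τ {i} {j} i<j fits rises = occurrence i<j fits (λ {t} t<k →
    subst₂ _<_ (at-++ˡ σ τ (ℕ.<-≤-trans i<j (ℕ.≤-trans (ℕ.m≤m+n j _) fits)))
               (at-++ˡ σ τ (ℕ.<-≤-trans (ℕ.+-monoʳ-< j t<k) fits))
               (rises t<k))

  reflects-⇔ : ∀ {A B : Set} {b} → A ⇔ B → Reflects A b → Reflects B b
  reflects-⇔ A⇔B (ofʸ a)  = ofʸ (Equivalence.to A⇔B a)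
  reflects-⇔ A⇔B (ofⁿ ¬a) = ofⁿ (¬a ∘ Equivalence.from A⇔B)

  module _ {k m : ℕ} {σ s : List ℕ} (m<σ : All (m <_) σ) (m<s : All (m <_) s) where

    private
      π = σ ++ m ∷ s
      p = length σ

      length-π : length π ≡ suc p + length s
      length-π = trans (List.length-++ σ) (ℕ.+-suc p (length s))

    Occurrence-split : Occurrence k π ⇔ (Occurrence k σ ⊎ k ≤ length s)
    Occurrence-split = mk⇔ split join
      where
      split : Occurrence k π → Occurrence k σ ⊎ k ≤ length s
      split (occurrence {i} {j} i<j fits rises) with (j + k) ≤? p | j ≤? p
      ... | yes j+k≤p | _       = inj₁ (Occurrence-++⁻ σ (m ∷ s) i<j j+k≤p rises)
      ... | no  j+k≰p | yes j≤p = contradiction (subst (at π i <_) πₚ≡m (rises t<k)) (ℕ.<-asym m<πᵢ)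
        where
        t<k : p ∸ j < k
        t<k = ℕ.+-cancelˡ-< j (p ∸ j) k (subst (_< j + k) (sym (ℕ.m+[n∸m]≡n j≤p)) (ℕ.≰⇒> j+k≰p))
        πₚ≡m : at π (j + (p ∸ j)) ≡ m
        πₚ≡m = trans (cong (at π) (ℕ.m+[n∸m]≡n j≤p)) (at-++-length σ m s)
        i<p : i < p
        i<p = ℕ.<-≤-trans i<j j≤p
        m<πᵢ : m < at π i
        m<πᵢ = subst (m <_) (sym (at-++ˡ σ (m ∷ s) i<p)) (at-All m<σ i<p)
      ... | no _      | no j≰p  = inj₂ (ℕ.+-cancelˡ-≤ (suc p) k (length s)
              (ℕ.≤-trans (ℕ.+-monoˡ-≤ k (ℕ.≰⇒> j≰p)) (subst (j + k ≤_) length-π fits)))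
      join : Occurrence k σ ⊎ k ≤ length s → Occurrence k π
      join (inj₁ occ) = Occurrence-++ˡ σ (m ∷ s) occ
      join (inj₂ k≤s) = occurrence (ℕ.n<1+n p) (subst (suc p + k ≤_) (sym length-π) (ℕ.+-monoʳ-≤ (suc p) k≤s))
        (λ {t} t<k → subst₂ _<_ (sym (at-++-length σ m s))
                                (sym (trans (cong (at π) (sym (ℕ.+-suc p t))) (at-++ʳ σ (m ∷ s) (suc t))))
                                (at-All m<s (ℕ.<-≤-trans t<k k≤s)))

    avoids-split : 1 ≤ k → not (occurs k π) ≡ not (occurs k σ) ∧ (length s <ᵇ k)
    avoids-split 1≤k = det (reflects-⇔ avoids⇔ (¬-reflects (occurs-reflects 1≤k π)))
                           (¬-reflects (occurs-reflects 1≤k σ) ×-reflects ℕ.<ᵇ-reflects-< (length s) k)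
      where
      open Equivalence Occurrence-split
      avoids⇔ : (¬ Occurrence k π) ⇔ (¬ Occurrence k σ × length s < k)
      avoids⇔ = mk⇔ (λ ¬occ → ¬occ ∘ from ∘ inj₁ , ℕ.≰⇒> (¬occ ∘ from ∘ inj₂))
                    (λ (¬occσ , s<k) → [ ¬occσ , ℕ.<⇒≱ s<k ] ∘ to)

module AvoiderCount (k : ℕ) (1≤k : 1 ≤ k) where

  open import Data.Nat as ℕ using (ℕ; zero; suc; _+_; _*_; _≤_; _<_; _<ᵇ_)
  import Data.Nat.Properties as ℕ
  open import Data.Bool using (Bool; true; false; if_then_else_; not; _∧_)
  import Data.Bool.Properties as Bool
  open import Data.List using (List; []; _∷_; [_]; length; _++_; _∷ʳ_)
  import Data.List.Properties as List
  open import Data.List.Extrema ℕ.≤-totalOrder using (min; argmin-sel; min≤⊤; min≤xs)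
  open import Data.List.Membership.Propositional using (_∈_)
  open import Data.List.Relation.Unary.Any using (here; there)
  open import Data.List.Relation.Unary.All as All using (All; []; _∷_)
  open import Data.List.Relation.Unary.Unique.Propositional using (Unique)
  import Data.List.Relation.Unary.Unique.Propositional.Properties as Unique
  import Data.List.Membership.Propositional.Properties as ∈
  open import Data.Sum using ([_,_]′)
  open import Function using (_∘_; id)
  open import Relation.Nullary using (contradiction)
  open import Data.Product using (proj₁; proj₂)
  open import Relation.Binary.PropositionalEquality hiding ([_])
  open Alphabets
  open Arrangements
  open PatternOccurrence

  avoids : List ℕ → Bool
  avoids π = not (occurs k π)

  mutual
    avoiders : ℕ → ℕ
    avoiders zero    = 1
    avoiders (suc l) = avoidersWithTail (suc l) 0

    -- avoidersWithTail l t counts the arrangements π of l letters with least letter m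
    -- such that π ++ τ avoids the pattern, for any tail τ of t letters above m; the
    -- recursion splits on whether the last letter of π is m or joins τ.
    avoidersWithTail : ℕ → ℕ → ℕ
    avoidersWithTail zero    t = 0
    avoidersWithTail (suc l) t = (if t <ᵇ k then avoiders l else 0) + l * avoidersWithTail l (suc t)

  mutual
    #arrangements-avoids : ∀ l {A} → Unique A → length A ≡ l → #arrangements l avoids A ≡ avoiders l
    #arrangements-avoids zero    {[]}    _  _   = refl
    #arrangements-avoids (suc l) {x ∷ A} uA len = begin
      #arrangements (suc l) avoids (x ∷ A)
        ≡⟨ #arrangements-cong (suc l) (x ∷ A) (λ w → cong avoids (sym (List.++-identityʳ w))) ⟩
      #arrangements (suc l) (λ π → avoids (π ++ [])) (x ∷ A)
        ≡⟨ #arrangements-tail l uA len min∈ (min≤⊤ x A ∷ min≤xs x A) [] ⟩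
      avoidersWithTail (suc l) 0
        ∎
      where
      open ≡-Reasoning
      min∈ : min x A ∈ x ∷ A
      min∈ = [ here , there ]′ (argmin-sel id x A)

    #arrangements-tail : ∀ l {m s A} → Unique A → length A ≡ suc l → m ∈ A → All (m ≤_) A → All (m <_) s →
                         #arrangements (suc l) (λ π → avoids (π ++ s)) A ≡ avoidersWithTail (suc l) (length s)
    #arrangements-tail l {m} {s} {A} uA len m∈A m≤A m<s = begin
      #arrangements (suc l) (λ π → avoids (π ++ s)) A
        ≡⟨ #arrangements-last l (λ π → avoids (π ++ s)) A ⟩
      ∑[ x ∈ A ] G x
        ≡⟨ ∑-remove G uA m∈A ⟩
      G m + ∑[ x ∈ remove m A ] G x
        ≡⟨ cong₂ _+_ last-is-min last-is-other ⟩
      (if length s <ᵇ k then avoiders l else 0) + l * avoidersWithTail l (suc (length s))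
        ∎
      where
      open ≡-Reasoning
      G : ℕ → ℕ
      G x = #arrangements l (λ w → avoids ((w ∷ʳ x) ++ s)) (remove x A)
      length-rest : length (remove m A) ≡ l
      length-rest = length-remove uA m∈A len
      last-is-other : ∑[ x ∈ remove m A ] G x ≡ l * avoidersWithTail l (suc (length s))
      last-is-other = trans (∑-const (remove m A) (#arrangements-tail-other l uA len m∈A m≤A m<s))
                            (cong (_* _) length-rest)
      last-is-min : G m ≡ (if length s <ᵇ k then avoiders l else 0)
      last-is-min = begin
        #arrangements l (λ w → avoids ((w ∷ʳ m) ++ s)) (remove m A)
          ≡⟨ #arrangements-cong-All l (remove m A) (remove-min m≤A) (λ {w} m<w →
               trans (cong avoids (List.++-assoc w [ m ] s)) (avoids-split m<w m<s 1≤k)) ⟩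
        #arrangements l (λ w → avoids w ∧ (length s <ᵇ k)) (remove m A)
          ≡⟨ by-tail-length (length s <ᵇ k) ⟩
        (if length s <ᵇ k then avoiders l else 0)
          ∎
        where
        by-tail-length : ∀ b → #arrangements l (λ w → avoids w ∧ b) (remove m A) ≡ (if b then avoiders l else 0)
        by-tail-length true  = trans (#arrangements-cong l (remove m A) (Bool.∧-identityʳ ∘ avoids))
                                     (#arrangements-avoids l (Unique-remove m uA) length-rest)
        by-tail-length false = trans (#arrangements-cong l (remove m A) (Bool.∧-zeroʳ ∘ avoids))
                                     (#arrangements-false l (remove m A))

    #arrangements-tail-other : ∀ l {m s A x} → Unique A → length A ≡ suc l → m ∈ A → All (m ≤_) A → All (m <_) s →
                               x ∈ remove m A →
                               #arrangements l (λ w → avoids ((w ∷ʳ x) ++ s)) (remove x A) ≡ avoidersWithTail l (suc (length s))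
    #arrangements-tail-other zero    uA len m∈A _ _ x∈ =
      contradiction (subst (0 <_) (length-remove uA m∈A len) (∈.∈-length x∈)) ℕ.n≮0
    #arrangements-tail-other (suc l) {m} {s} {A} {x} uA len m∈A m≤A m<s x∈ = begin
      #arrangements (suc l) (λ w → avoids ((w ∷ʳ x) ++ s)) (remove x A)
        ≡⟨ #arrangements-cong (suc l) (remove x A) (λ w → cong avoids (List.++-assoc w [ x ] s)) ⟩
      #arrangements (suc l) (λ w → avoids (w ++ x ∷ s)) (remove x A)
        ≡⟨ #arrangements-tail l (Unique-remove x uA) length-rest (∈-remove⁺ m∈A (m≢x ∘ sym))
                                (All-remove x m≤A) (m<x ∷ m<s) ⟩
      avoidersWithTail (suc l) (suc (length s))
        ∎
      where
      open ≡-Reasoning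
      x∈A = proj₁ (∈-remove⁻ {A = A} x∈)
      m≢x = proj₂ (∈-remove⁻ {A = A} x∈)
      m<x : m < x
      m<x = ℕ.≤∧≢⇒< (All.lookup m≤A x∈A) m≢x
      length-rest : length (remove x A) ≡ suc l
      length-rest = length-remove uA x∈A len

  avoidCount≡avoiders : ∀ n → avoidCount k n ≡ avoiders n
  avoidCount≡avoiders n = trans (count-perms avoids n) (#arrangements-avoids n (Unique.upTo⁺ n) (List.length-upTo n))

module AvoiderEGF (k : ℕ) (1≤k : 1 ≤ k) where

  open import Data.Nat as ℕ using (ℕ; zero; suc; _+_; _∸_; _!; _<ᵇ_)
  import Data.Nat.Properties as ℕ
  open import Data.Bool using (Bool; true; false; if_then_else_)
  open import Data.Integer using (+_)
  open import Data.Rational using (ℚ; 0ℚ; 1ℚ; _/_) renaming (_+_ to _+ℚ_; _*_ to _*ℚ_)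
  open import Data.Rational.Properties
  open import Data.Rational.Solver using (module +-*-Solver)
  open import Algebra.Bundles using (CommutativeMonoid)
  open import Algebra.Properties.CommutativeSemigroup (CommutativeMonoid.commutativeSemigroup *-1-commutativeMonoid)
    using (x∙yz≈y∙xz; xy∙z≈y∙xz)
  open import Relation.Binary.PropositionalEquality
  open NatToRational
  open FiniteSums
  open PowerSeries
  open AvoiderCount k 1≤k
  open +-*-Solver

  𝟙 : Bool → ℚ
  𝟙 b = if b then 1ℚ else 0ℚ

  fromℕ-if : ∀ b x → fromℕ (if b then x else 0) ≡ 𝟙 b *ℚ fromℕ x
  fromℕ-if true  x = sym (*-identityˡ (fromℕ x))
  fromℕ-if false x = sym (*-zeroˡ (fromℕ x))

  θ-logSeries : ∀ j → θ (logSeries k) (suc j) ≡ 𝟙 (j <ᵇ k)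
  θ-logSeries j with j <ᵇ k
  ... | true  = trans (*-comm (fromℕ (suc j)) (+ 1 / suc j)) (/-*-fromℕ 1 (suc j))
  ... | false = *-zeroʳ (fromℕ (suc j))

  avoidersEGF : PS
  avoidersEGF n = fromℕ (avoiders n) *ℚ inv! n

  avoidEGF≡avoidersEGF : ∀ n → avoidEGF k n ≡ avoidersEGF n
  avoidEGF≡avoidersEGF n = trans (a/b≡a*[1/b] (avoidCount k n) (n !) {{n ℕ.!≢0}})
                                 (cong (λ c → fromℕ c *ℚ inv! n) (avoidCount≡avoiders n))

  avoidersWithTail-closedForm : ∀ l t → fromℕ (avoidersWithTail (suc l) t) *ℚ inv! l
                                        ≡ sumTo l (λ j → 𝟙 ((t + j) <ᵇ k) *ℚ avoidersEGF (l ∸ j))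
  avoidersWithTail-closedForm zero t rewrite ℕ.+-identityʳ t with t <ᵇ k
  ... | true  = refl
  ... | false = refl
  avoidersWithTail-closedForm (suc l) t = begin
    fromℕ (avoidersWithTail (suc (suc l)) t) *ℚ inv! (suc l)
      ≡⟨ cong (_*ℚ inv! (suc l)) (trans (fromℕ-+ (if t <ᵇ k then a else 0) (suc l ℕ.* W))
                                          (cong₂ _+ℚ_ (fromℕ-if (t <ᵇ k) a) (fromℕ-* (suc l) W))) ⟩
    (𝟙 (t <ᵇ k) *ℚ fromℕ a +ℚ fromℕ (suc l) *ℚ fromℕ W) *ℚ inv! (suc l)
      ≡⟨ regroup (𝟙 (t <ᵇ k)) (fromℕ a) (fromℕ (suc l)) (fromℕ W) (inv! (suc l)) ⟩
    𝟙 (t <ᵇ k) *ℚ u (suc l) +ℚ fromℕ W *ℚ (fromℕ (suc l) *ℚ inv! (suc l))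
      ≡⟨ cong (λ x → 𝟙 (t <ᵇ k) *ℚ u (suc l) +ℚ fromℕ W *ℚ x) (fromℕ-*-inv! l) ⟩
    𝟙 (t <ᵇ k) *ℚ u (suc l) +ℚ fromℕ W *ℚ inv! l
      ≡⟨ cong₂ _+ℚ_ (cong (λ i → 𝟙 (i <ᵇ k) *ℚ u (suc l)) (sym (ℕ.+-identityʳ t)))
                    (avoidersWithTail-closedForm l (suc t)) ⟩
    𝟙 ((t + 0) <ᵇ k) *ℚ u (suc l) +ℚ sumTo l (λ j → 𝟙 ((suc t + j) <ᵇ k) *ℚ u (l ∸ j))
      ≡⟨ cong (𝟙 ((t + 0) <ᵇ k) *ℚ u (suc l) +ℚ_)
              (sumTo-cong l (λ j → cong (λ i → 𝟙 (i <ᵇ k) *ℚ u (l ∸ j)) (ℕ.+-suc t j))) ⟨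
    𝟙 ((t + 0) <ᵇ k) *ℚ u (suc l) +ℚ sumTo l (λ j → 𝟙 ((t + suc j) <ᵇ k) *ℚ u (l ∸ j))
      ≡⟨ sumTo-shift l (λ j → 𝟙 ((t + j) <ᵇ k) *ℚ u (suc l ∸ j)) ⟨
    sumTo (suc l) (λ j → 𝟙 ((t + j) <ᵇ k) *ℚ u (suc l ∸ j))
      ∎
    where
    open ≡-Reasoning
    u = avoidersEGF
    a = avoiders (suc l)
    W = avoidersWithTail (suc l) (suc t)
    regroup : ∀ b x c y z → (b *ℚ x +ℚ c *ℚ y) *ℚ z ≡ b *ℚ (x *ℚ z) +ℚ y *ℚ (c *ℚ z)
    regroup = solve 5 (λ b x c y z → (b :* x :+ c :* y) :* z := b :* (x :* z) :+ y :* (c :* z)) refl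

  θ-avoidersEGF : θ avoidersEGF ≗ θ (logSeries k) ⊗ avoidersEGF
  θ-avoidersEGF zero    = refl
  θ-avoidersEGF (suc l) = begin
    fromℕ (suc l) *ℚ (fromℕ (avoiders (suc l)) *ℚ inv! (suc l))
      ≡⟨ x∙yz≈y∙xz (fromℕ (suc l)) (fromℕ (avoiders (suc l))) (inv! (suc l)) ⟩
    fromℕ (avoiders (suc l)) *ℚ (fromℕ (suc l) *ℚ inv! (suc l))
      ≡⟨ cong (fromℕ (avoiders (suc l)) *ℚ_) (fromℕ-*-inv! l) ⟩
    fromℕ (avoidersWithTail (suc l) 0) *ℚ inv! l
      ≡⟨ avoidersWithTail-closedForm l 0 ⟩
    sumTo l (λ j → 𝟙 (j <ᵇ k) *ℚ avoidersEGF (l ∸ j))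
      ≡⟨ sumTo-cong l (λ j → cong (_*ℚ avoidersEGF (l ∸ j)) (θ-logSeries j)) ⟨
    sumTo l (λ j → θ L (suc j) *ℚ avoidersEGF (l ∸ j))
      ≡⟨ +-identityˡ _ ⟨
    0ℚ +ℚ sumTo l (λ j → θ L (suc j) *ℚ avoidersEGF (l ∸ j))
      ≡⟨ cong (_+ℚ sumTo l (λ j → θ L (suc j) *ℚ avoidersEGF (l ∸ j))) (*-zeroˡ (avoidersEGF (suc l))) ⟨
    θ L 0 *ℚ avoidersEGF (suc l) +ℚ sumTo l (λ j → θ L (suc j) *ℚ avoidersEGF (l ∸ j))
      ≡⟨ sumTo-shift l (λ i → θ L i *ℚ avoidersEGF (suc l ∸ i)) ⟨
    (θ L ⊗ avoidersEGF) (suc l)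
      ∎
    where
    open ≡-Reasoning
    L = logSeries k

mainTheorem2 : (k : ℕ) → 1 ≤ k → (n : ℕ) → avoidEGF k n ≡ expPS (logSeries k) n
mainTheorem2 k 1≤k n = begin
  avoidEGF k n   ≡⟨ avoidEGF≡avoidersEGF n ⟩
  avoidersEGF n  ≡⟨ θ-ode-unique (θ L) avoidersEGF (expPS L) refl θ-avoidersEGF (θ-expPS L refl) refl n ⟩
  expPS L n      ∎
  where
  open ≡-Reasoning
  open PowerSeries
  open AvoiderEGF k 1≤k
  L = logSeries k
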